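{- Let $G=(I\uplus S\uplus O,E)$ be an $(n,p)$-balancer such that, when all input capacities are $1$ (and all output capacities are $1$), the steady-state has no saturated arc. Then \[|S|\ \ge\ \frac12\,|I|\,|O|\sum_{k\in\mathbb{N}}\frac{k}{2^k}\,b_k\!\left(\frac{1}{|O|}\right),\] where $b_k(x)\in\{0,1\}$ denotes the digit of weight $2^{ -k}$ in the binary expansion of $x\in[0,1]$.
   Context: A splitter network is a finite directed graph $G$ (loops and parallel arcs allowed) with arc set $E$ whose vertex set is partitioned as $I\uplus S\uplus O$, where each input $i\in I$ has out-degree $1$ and in-degree $0$, each output $o\in O$ has in-degree $1$ and out-degree $0$, and each splitter $s\in S$ has in-degree $2$ and out-degree $2$. $\delta^+(v),\delta^-(v)$ denote outgoing/incoming arcs of $v$, and $\delta^-(O)$ the set of arcs entering outputs. A capacity function is a map $c:I\cup O\to[0,1]$. A steady-state for $(G,c)$ is a pair $(t,F)$ with $t:E\to[0,1]$ and $F\subseteq E$ (fluid arcs; arcs of $E\setminus F$ are saturated) such that: (R3) for each input $i$ with $\delta^+(i)=\{e\}$, $t(e)\le c(i)$, and if $e\in F$ then $t(e)=c(i)$; (R4) for each output $o$ with $\delta^-(o)=\{e\}$, $t(e)\le c(o)$, and if $e\notin F$ then $t(e)=c(o)$; (R5) for each splitter $s$, $t(\delta^-(s))=t(\delta^+(s))$; (R6) for each splitter $s$ with $\delta^-(s)=\{e_1,e_2\}$ and $e_1\notin F$, $t(e_1)\ge t(e_2)$; (R7) for each splitter $s$ with $\delta^+(s)=\{e_1,e_2\}$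 and $e_1\in F$, $t(e_1)\ge t(e_2)$; (R8) for any arcs $uv\in E\setminus F$ and $vw\in F$, $t(uv)=1$ or $t(vw)=1$. A splitter network is a balancer if for every capacity function $c$ with $c(o)=1$ for all $o\in O$ there is a steady-state $(t,F)$ for $(G,c)$ with $t$ constant on $\delta^-(O)$. An $(n,p)$-balancer is a balancer with $|I|=n$ and $|O|=p$.
   Formalization: The capacity functions and the steady-state throughputs t take rational values in [0,1] instead of real ones. -}

module Defs where

open import Data.Nat as ℕ using (ℕ; zero; suc; _%_)
open import Data.Fin using (Fin)
import Data.Nat.Properties
import Data.Integer
open import Data.Fin.Properties using () renaming (_≟_ to _≟F_)
open import Data.Sum using (_⊎_; inj₁; inj₂)
open import Data.Sum.Properties using (≡-dec)
open import Data.Bool using (Bool; true; false)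
open import Data.List using (List; filter; length; foldr; map; allFin; upTo)
open import Data.Product using (Σ; _×_; _,_; ∃)
open import Data.Integer using (ℤ; ∣_∣)
open import Data.Rational using (ℚ; _+_; _*_; _≤_; 0ℚ; 1ℚ; ½; floor; _/_)
open import Relation.Binary.PropositionalEquality using (_≡_; _≢_)
open import Relation.Nullary using (¬_; Dec)
open import Relation.Binary.Definitions using (DecidableEquality)

Vertex : ℕ → ℕ → ℕ → Set
Vertex n s p = Fin n ⊎ (Fin s ⊎ Fin p)

inV : ∀ {n s p} → Fin n → Vertex n s p
inV i = inj₁ i

spV : ∀ {n s p} → Fin s → Vertex n s p
spV x = inj₂ (inj₁ x)

outV : ∀ {n s p} → Fin p → Vertex n s p
outV o = inj₂ (inj₂ o)

_≟V_ : ∀ {n s p} → DecidableEquality (Vertex n s p)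
_≟V_ = ≡-dec _≟F_ (≡-dec _≟F_ _≟F_)

record SplitterNetwork (n s p : ℕ) : Set where
  field
    m    : ℕ
    tail : Fin m → Vertex n s p
    head : Fin m → Vertex n s p

  δ⁺ : Vertex n s p → List (Fin m)
  δ⁺ v = filter (λ e → tail e ≟V v) (allFin m)

  δ⁻ : Vertex n s p → List (Fin m)
  δ⁻ v = filter (λ e → head e ≟V v) (allFin m)

  field
    in-out  : ∀ i → length (δ⁺ (inV i)) ≡ 1
    in-in   : ∀ i → length (δ⁻ (inV i)) ≡ 0
    out-in  : ∀ o → length (δ⁻ (outV o)) ≡ 1
    out-out : ∀ o → length (δ⁺ (outV o)) ≡ 0
    sp-in   : ∀ x → length (δ⁻ (spV x)) ≡ 2
    sp-out  : ∀ x → length (δ⁺ (spV x)) ≡ 2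

open SplitterNetwork public

sumℚ : List ℚ → ℚ
sumℚ = foldr _+_ 0ℚ

InUnit : ℚ → Set
InUnit x = (0ℚ ≤ x) × (x ≤ 1ℚ)

-- A steady-state (t , F) for (G , c), where c is given by its values on
-- inputs (cI) and outputs (cO).  F : E → Bool is the set of fluid arcs
-- (e ∈ F  iff  F e ≡ true); arcs with F e ≡ false are saturated.
record IsSteadyState {n s p} (G : SplitterNetwork n s p)
         (cI : Fin n → ℚ) (cO : Fin p → ℚ)
         (t : Fin (m G) → ℚ) (F : Fin (m G) → Bool) : Set where
  field
    t-range : ∀ e → InUnit (t e)
    R3-le : ∀ i e → tail G e ≡ inV i → t e ≤ cI i
    R3-eq : ∀ i e → tail G e ≡ inV i → F e ≡ true → t e ≡ cI i
    R4-le : ∀ o e → head G e ≡ outV o → t e ≤ cO o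
    R4-eq : ∀ o e → head G e ≡ outV o → F e ≡ false → t e ≡ cO o
    R5 : ∀ x → sumℚ (map t (δ⁻ G (spV x))) ≡ sumℚ (map t (δ⁺ G (spV x)))
    R6 : ∀ x e₁ e₂ → e₁ ≢ e₂ → head G e₁ ≡ spV x → head G e₂ ≡ spV x →
         F e₁ ≡ false → t e₂ ≤ t e₁
    R7 : ∀ x e₁ e₂ → e₁ ≢ e₂ → tail G e₁ ≡ spV x → tail G e₂ ≡ spV x →
         F e₁ ≡ true → t e₂ ≤ t e₁
    R8 : ∀ e₁ e₂ → head G e₁ ≡ tail G e₂ → F e₁ ≡ false → F e₂ ≡ true →
         (t e₁ ≡ 1ℚ) ⊎ (t e₂ ≡ 1ℚ)

IsBalancer : ∀ {n s p} → SplitterNetwork n s p → Set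
IsBalancer {n} {s} {p} G =
  (cI : Fin n → ℚ) → (∀ i → InUnit (cI i)) →
  Σ (Fin (m G) → ℚ) λ t → Σ (Fin (m G) → Bool) λ F →
    IsSteadyState G cI (λ _ → 1ℚ) t F ×
    (∀ e e' o o' → head G e ≡ outV o → head G e' ≡ outV o' → t e ≡ t e')

-- Binary digit of weight 2^{-k} of x ∈ [0,1]: b_k(x) = ⌊2^k x⌋ mod 2
-- (the terminating expansion is used for dyadic x).
binDigit : ℕ → ℚ → ℕ
binDigit k x = ∣ floor ((Data.Integer.+ (2 ℕ.^ k) / 1) * x) ∣ % 2

digitSum : ℕ → ℚ → ℚ
digitSum K x =
  sumℚ (map (λ k → (Data.Integer.+ (k ℕ.* binDigit k x) / (2 ℕ.^ k)) {{nz k}}) (upTo K))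
  where
    nz : ∀ k → ℕ.NonZero (2 ℕ.^ k)
    nz k = Data.Nat.Properties.m^n≢0 2 k

module Submission where

-- Track the flow of each input separately, in discrete time: commodity i enters at input i one
-- unit per step, and each splitter forwards half of what it received along each out-arc. In the
-- all-fluid steady state the commodities together never exceed the throughput, so their total
-- inflow into splitters is at most 2|S|. In a balanced steady state fed by input i alone every
-- output carries at most 1/p, and the flow of i reaching an output after k + 1 steps is a multiple
-- of 2⁻ᵏ, hence at most the k-digit truncation of 1/p. So of the unit injected at each step k at
-- most p·trunc_k(1/p) leaves, the splitters retain at least p·Σ_{k<K}(1/p − trunc_k(1/p)), and
-- this sum dominates Σ_{k<K} k b_k(1/p) 2⁻ᵏ. Summing over the n inputs gives n·p·Σ ≤ 2|S|.

open import Defs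
open import Data.Nat using (ℕ; NonZero)
open import Data.Fin using (Fin)
open import Data.Bool using (true)
open import Data.Product using (Σ)
open import Data.Integer using (+_)
open import Data.Rational using (ℚ; _*_; _≤_; _/_; 1ℚ; ½)

open import Data.Nat as ℕ using (zero; suc; _^_)
import Data.Nat.Properties as ℕP
import Data.Nat.DivMod as ℕD
open import Data.Nat.Coprimality using (Coprime)
open import Data.Fin as Fin using ()
import Data.Integer as ℤ
import Data.Integer.Properties as ℤP
import Data.Integer.DivMod as ℤD
open import Data.Rational using (_+_; _-_; -_; _<_; 0ℚ; floor; mkℚ; toℚᵘ; nonNegative; *≤*)
import Data.Rational.Properties as ℚP
open import Data.Rational.Unnormalised as ℚᵘ using (mkℚᵘ)
import Data.Rational.Unnormalised.Properties as ℚᵘP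
open import Data.Rational.Solver using (module +-*-Solver)
import Algebra.Properties.Group as GroupProperties
open import Data.List using (List; []; _∷_; map; filter; length; _++_; upTo; _∷ʳ_; allFin)
open import Data.List.Properties using (map-++; map-∘; upTo-∷ʳ; length-tabulate)
open import Data.List.Membership.Propositional using (_∈_; _∉_)
open import Data.List.Membership.Propositional.Properties using (∈-filter⁺; ∈-filter⁻; ∈-map⁺; ∈-map⁻; ∈-allFin)
open import Data.List.Relation.Unary.Any using (here; there)
open import Data.List.Relation.Unary.All using (_∷_; [])
open import Data.List.Relation.Unary.All.Properties using (All¬⇒¬Any)
open import Data.List.Relation.Unary.AllPairs using (_∷_)
open import Data.List.Relation.Unary.Unique.Propositional using (Unique)
import Data.List.Relation.Unary.Unique.Propositional.Properties as Unique
open import Data.Bool using (Bool; false; if_then_else_)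
open import Data.Product using (_×_; _,_; proj₁; proj₂)
open import Data.Sum using (_⊎_; inj₁; inj₂)
open import Data.Sum.Properties using (inj₁-injective; inj₂-injective)
open import Relation.Nullary using (Dec; yes; no; does; contradiction)
open import Relation.Binary.Definitions using (DecidableEquality)
open import Relation.Binary.PropositionalEquality

open +-*-Solver using (solve; _:+_; _:*_; _:-_; _:=_; con)
open GroupProperties ℚP.+-0-group using (∙-cancelˡ)

fromℕ : ℕ → ℚ
fromℕ k = + k / 1

fromℕ-toℚᵘ : ∀ k → toℚᵘ (fromℕ k) ℚᵘ.≃ mkℚᵘ (+ k) 0
fromℕ-toℚᵘ k = ℚP.toℚᵘ-fromℚᵘ (mkℚᵘ (+ k) 0)

fromℕ-+ : ∀ a b → fromℕ (a ℕ.+ b) ≡ fromℕ a + fromℕ b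
fromℕ-+ a b = ℚP.toℚᵘ-injective (begin-equality
  toℚᵘ (fromℕ (a ℕ.+ b))            ≃⟨ fromℕ-toℚᵘ (a ℕ.+ b) ⟩
  mkℚᵘ (+ a ℤ.+ + b) 0              ≃⟨ ℚᵘ.*≡* (cong (ℤ._* + 1) (sym (cong₂ ℤ._+_ (ℤP.*-identityʳ (+ a)) (ℤP.*-identityʳ (+ b))))) ⟩
  mkℚᵘ (+ a) 0 ℚᵘ.+ mkℚᵘ (+ b) 0   ≃⟨ ℚᵘP.+-cong (fromℕ-toℚᵘ a) (fromℕ-toℚᵘ b) ⟨
  toℚᵘ (fromℕ a) ℚᵘ.+ toℚᵘ (fromℕ b) ≃⟨ ℚP.toℚᵘ-homo-+ (fromℕ a) (fromℕ b) ⟨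
  toℚᵘ (fromℕ a + fromℕ b)          ∎)
  where open ℚᵘP.≤-Reasoning

fromℕ-* : ∀ a b → fromℕ (a ℕ.* b) ≡ fromℕ a * fromℕ b
fromℕ-* a b = ℚP.toℚᵘ-injective (begin-equality
  toℚᵘ (fromℕ (a ℕ.* b))            ≃⟨ fromℕ-toℚᵘ (a ℕ.* b) ⟩
  mkℚᵘ (+ (a ℕ.* b)) 0              ≃⟨ ℚᵘ.*≡* (cong (ℤ._* + 1) (ℤP.pos-* a b)) ⟩
  mkℚᵘ (+ a) 0 ℚᵘ.* mkℚᵘ (+ b) 0   ≃⟨ ℚᵘP.*-cong (fromℕ-toℚᵘ a) (fromℕ-toℚᵘ b) ⟨
  toℚᵘ (fromℕ a) ℚᵘ.* toℚᵘ (fromℕ b) ≃⟨ ℚP.toℚᵘ-homo-* (fromℕ a) (fromℕ b) ⟨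
  toℚᵘ (fromℕ a * fromℕ b)          ∎)
  where open ℚᵘP.≤-Reasoning

fromℕ-mono-≤ : ∀ {a b} → a ℕ.≤ b → fromℕ a ≤ fromℕ b
fromℕ-mono-≤ {a} {b} a≤b = ℚP.toℚᵘ-cancel-≤
  (ℚᵘP.≤-respˡ-≃ (ℚᵘP.≃-sym (fromℕ-toℚᵘ a)) (ℚᵘP.≤-respʳ-≃ (ℚᵘP.≃-sym (fromℕ-toℚᵘ b))
    (ℚᵘ.*≤* (ℤP.*-monoʳ-≤-nonNeg (+ 1) (ℤ.+≤+ a≤b)))))

fromℕ-cancel-< : ∀ {a b} → fromℕ a < fromℕ b → a ℕ.< b
fromℕ-cancel-< a<b = ℕP.≰⇒> λ b≤a → ℚP.<-irrefl refl (ℚP.<-≤-trans a<b (fromℕ-mono-≤ b≤a))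

fromℕ-nonNeg : ∀ a → 0ℚ ≤ fromℕ a
fromℕ-nonNeg a = fromℕ-mono-≤ {0} {a} ℕ.z≤n

*-monoˡ-≤-nonNeg : ∀ {r a b} → 0ℚ ≤ r → a ≤ b → r * a ≤ r * b
*-monoˡ-≤-nonNeg {r} 0≤r = ℚP.*-monoˡ-≤-nonNeg r {{nonNegative 0≤r}}

*-monoʳ-≤-nonNeg : ∀ {r a b} → 0ℚ ≤ r → a ≤ b → a * r ≤ b * r
*-monoʳ-≤-nonNeg {r} 0≤r = ℚP.*-monoʳ-≤-nonNeg r {{nonNegative 0≤r}}

*-nonNeg : ∀ {a b} → 0ℚ ≤ a → 0ℚ ≤ b → 0ℚ ≤ a * b
*-nonNeg {a} {b} 0≤a 0≤b = subst (_≤ a * b) (ℚP.*-zeroʳ a) (*-monoˡ-≤-nonNeg 0≤a 0≤b)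

p≤q⇒0≤q-p : ∀ {p q} → p ≤ q → 0ℚ ≤ q - p
p≤q⇒0≤q-p {p} {q} p≤q = subst (_≤ q - p) (ℚP.+-inverseʳ p) (ℚP.+-monoˡ-≤ (- p) p≤q)

/-toℚᵘ : ∀ a d .{{_ : NonZero d}} → toℚᵘ (+ a / d) ℚᵘ.≃ mkℚᵘ (+ a) (ℕ.pred d)
/-toℚᵘ a (suc d) = ℚP.toℚᵘ-fromℚᵘ (mkℚᵘ (+ a) d)

/≡fromℕ*1/ : ∀ a d .{{_ : NonZero d}} → + a / d ≡ fromℕ a * (+ 1 / d)
/≡fromℕ*1/ a d@(suc d-1) = ℚP.toℚᵘ-injective (begin-equality
  toℚᵘ (+ a / d)                             ≃⟨ /-toℚᵘ a d ⟩
  mkℚᵘ (+ a) d-1                             ≃⟨ ℚᵘ.*≡* (cong₂ ℤ._*_ (sym (ℤP.*-identityʳ (+ a))) (cong +_ (ℕP.*-identityˡ d))) ⟩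
  mkℚᵘ (+ a) 0 ℚᵘ.* mkℚᵘ (+ 1) d-1          ≃⟨ ℚᵘP.*-cong (fromℕ-toℚᵘ a) (/-toℚᵘ 1 d) ⟨
  toℚᵘ (fromℕ a) ℚᵘ.* toℚᵘ (+ 1 / d)        ≃⟨ ℚP.toℚᵘ-homo-* (fromℕ a) (+ 1 / d) ⟨
  toℚᵘ (fromℕ a * (+ 1 / d))                ∎)
  where open ℚᵘP.≤-Reasoning

1/-nonNeg : ∀ d .{{_ : NonZero d}} → 0ℚ ≤ + 1 / d
1/-nonNeg d = ℚP.nonNegative⁻¹ _ {{ℚP.normalize-nonNeg 1 d}}

1/d*d≡1 : ∀ d .{{_ : NonZero d}} → (+ 1 / d) * fromℕ d ≡ 1ℚ
1/d*d≡1 d@(suc d-1) = ℚP.toℚᵘ-injective (begin-equality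
  toℚᵘ ((+ 1 / d) * fromℕ d)              ≃⟨ ℚP.toℚᵘ-homo-* (+ 1 / d) (fromℕ d) ⟩
  toℚᵘ (+ 1 / d) ℚᵘ.* toℚᵘ (fromℕ d)     ≃⟨ ℚᵘP.*-cong (/-toℚᵘ 1 d) (fromℕ-toℚᵘ d) ⟩
  mkℚᵘ (+ 1) d-1 ℚᵘ.* mkℚᵘ (+ d) 0
    ≃⟨ ℚᵘ.*≡* (trans (ℤP.*-identityʳ _) (trans (ℤP.*-identityˡ _) (trans (cong +_ (sym (ℕP.*-identityʳ d))) (sym (ℤP.*-identityˡ _))))) ⟩
  toℚᵘ 1ℚ                                 ∎)
  where open ℚᵘP.≤-Reasoning

y*d≡1⇒y≡1/d : ∀ d .{{_ : NonZero d}} {y} → y * fromℕ d ≡ 1ℚ → y ≡ + 1 / d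
y*d≡1⇒y≡1/d d {y} yd≡1 = begin
  y                         ≡⟨ ℚP.*-identityʳ y ⟨
  y * 1ℚ                    ≡⟨ cong (y *_) (trans (ℚP.*-comm (fromℕ d) _) (1/d*d≡1 d)) ⟨
  y * (fromℕ d * (+ 1 / d)) ≡⟨ ℚP.*-assoc y (fromℕ d) _ ⟨
  y * fromℕ d * (+ 1 / d)   ≡⟨ cong (_* (+ 1 / d)) yd≡1 ⟩
  1ℚ * (+ 1 / d)            ≡⟨ ℚP.*-identityˡ _ ⟩
  + 1 / d                   ∎
  where open ≡-Reasoning

d*y≤1⇒y≤1/d : ∀ d .{{_ : NonZero d}} {y} → fromℕ d * y ≤ 1ℚ → y ≤ + 1 / d
d*y≤1⇒y≤1/d d {y} dy≤1 = begin
  y                          ≡⟨ ℚP.*-identityʳ y ⟨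
  y * 1ℚ                     ≡⟨ cong (y *_) (trans (ℚP.*-comm (fromℕ d) _) (1/d*d≡1 d)) ⟨
  y * (fromℕ d * (+ 1 / d))  ≡⟨ solve 3 (λ y a x → y :* (a :* x) := (a :* y) :* x) refl y (fromℕ d) (+ 1 / d) ⟩
  fromℕ d * y * (+ 1 / d)    ≤⟨ *-monoʳ-≤-nonNeg (1/-nonNeg d) dy≤1 ⟩
  1ℚ * (+ 1 / d)             ≡⟨ ℚP.*-identityˡ _ ⟩
  + 1 / d                    ∎
  where open ℚP.≤-Reasoning

⌊_⌋ℕ : ℚ → ℕ
⌊ q ⌋ℕ = ℤ.∣ floor q ∣

private
  fromℕ≤mkℚ⇒ : ∀ {z a d-1} .{c : Coprime a (suc d-1)} → fromℕ z ≤ mkℚ (+ a) d-1 c → z ℕ.* suc d-1 ℕ.≤ a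
  fromℕ≤mkℚ⇒ {z} {a} {d-1} z≤q with ℚᵘP.≤-respˡ-≃ (fromℕ-toℚᵘ z) (ℚP.toℚᵘ-mono-≤ z≤q)
  ... | ℚᵘ.*≤* z*d≤a = ℤP.drop‿+≤+ (subst₂ ℤ._≤_ (sym (ℤP.pos-* z (suc d-1))) (ℤP.*-identityʳ (+ a)) z*d≤a)

  ⇒fromℕ≤mkℚ : ∀ {z a d-1} .{c : Coprime a (suc d-1)} → z ℕ.* suc d-1 ℕ.≤ a → fromℕ z ≤ mkℚ (+ a) d-1 c
  ⇒fromℕ≤mkℚ {z} {a} {d-1} z*d≤a = ℚP.toℚᵘ-cancel-≤ (ℚᵘP.≤-respˡ-≃ (ℚᵘP.≃-sym (fromℕ-toℚᵘ z))
    (ℚᵘ.*≤* (subst₂ ℤ._≤_ (ℤP.pos-* z (suc d-1)) (sym (ℤP.*-identityʳ (+ a))) (ℤ.+≤+ z*d≤a))))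

  ⇒mkℚ<fromℕ : ∀ {z a d-1} .{c : Coprime a (suc d-1)} → a ℕ.< z ℕ.* suc d-1 → mkℚ (+ a) d-1 c < fromℕ z
  ⇒mkℚ<fromℕ {z} {a} {d-1} a<z*d = ℚP.toℚᵘ-cancel-< (ℚᵘP.<-respʳ-≃ (ℚᵘP.≃-sym (fromℕ-toℚᵘ z))
    (ℚᵘ.*<* (subst₂ ℤ._<_ (sym (ℤP.*-identityʳ (+ a))) (ℤP.pos-* z (suc d-1)) (ℤ.+<+ a<z*d))))

  ⌊mkℚ⌋ℕ : ∀ a d-1 .(c : Coprime a (suc d-1)) → ⌊ mkℚ (+ a) d-1 c ⌋ℕ ≡ a ℕ./ suc d-1
  ⌊mkℚ⌋ℕ a d-1 _ = cong ℤ.∣_∣ (ℤD.div-pos-is-/ℕ (+ a) (suc d-1))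

  m<[1+m/n]*n : ∀ m n .{{_ : NonZero n}} → m ℕ.< suc (m ℕ./ n) ℕ.* n
  m<[1+m/n]*n m n = subst (ℕ._< suc (m ℕ./ n) ℕ.* n) (sym (ℕD.m≡m%n+[m/n]*n m n))
    (ℕP.+-monoˡ-< ((m ℕ./ n) ℕ.* n) (ℕD.m%n<n m n))

≤⌊⌋ℕ : ∀ {q z} → 0ℚ ≤ q → fromℕ z ≤ q → z ℕ.≤ ⌊ q ⌋ℕ
≤⌊⌋ℕ {q@(mkℚ (+ a) d-1 c)} {z} _ z≤q = subst (z ℕ.≤_) (sym (⌊mkℚ⌋ℕ a d-1 c)) (begin
  z                        ≡⟨ ℕD.m*n/n≡m z (suc d-1) ⟨
  z ℕ.* suc d-1 ℕ./ suc d-1 ≤⟨ ℕD./-monoˡ-≤ (suc d-1) (fromℕ≤mkℚ⇒ {z} {a} {d-1} {c} z≤q) ⟩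
  a ℕ./ suc d-1             ∎)
  where open ℕP.≤-Reasoning
≤⌊⌋ℕ {mkℚ ℤ.-[1+ _ ] _ _} (*≤* ())

⌊⌋ℕ≤ : ∀ {q} → 0ℚ ≤ q → fromℕ ⌊ q ⌋ℕ ≤ q
⌊⌋ℕ≤ {q@(mkℚ (+ a) d-1 c)} _ = subst (λ w → fromℕ w ≤ q) (sym (⌊mkℚ⌋ℕ a d-1 c))
  (⇒fromℕ≤mkℚ {a ℕ./ suc d-1} {a} {d-1} {c} (ℕD.m/n*n≤m a (suc d-1)))
⌊⌋ℕ≤ {mkℚ ℤ.-[1+ _ ] _ _} (*≤* ())

<1+⌊⌋ℕ : ∀ {q} → 0ℚ ≤ q → q < fromℕ (suc ⌊ q ⌋ℕ)
<1+⌊⌋ℕ {q@(mkℚ (+ a) d-1 c)} _ = subst (λ w → q < fromℕ (suc w)) (sym (⌊mkℚ⌋ℕ a d-1 c))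
  (⇒mkℚ<fromℕ {suc (a ℕ./ suc d-1)} {a} {d-1} {c} (m<[1+m/n]*n a (suc d-1)))
<1+⌊⌋ℕ {mkℚ ℤ.-[1+ _ ] _ _} (*≤* ())

sumℚ-++ : ∀ xs ys → sumℚ (xs ++ ys) ≡ sumℚ xs + sumℚ ys
sumℚ-++ []       ys = sym (ℚP.+-identityˡ _)
sumℚ-++ (x ∷ xs) ys = trans (cong (_+_ x) (sumℚ-++ xs ys)) (sym (ℚP.+-assoc x _ _))

sumℚ-upTo-suc : ∀ (f : ℕ → ℚ) K → sumℚ (map f (upTo (suc K))) ≡ sumℚ (map f (upTo K)) + f K
sumℚ-upTo-suc f K = begin
  sumℚ (map f (upTo (suc K)))            ≡⟨ cong (λ xs → sumℚ (map f xs)) (upTo-∷ʳ K) ⟨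
  sumℚ (map f (upTo K ∷ʳ K))             ≡⟨ cong sumℚ (map-++ f (upTo K) (K ∷ [])) ⟩
  sumℚ (map f (upTo K) ++ f K ∷ [])      ≡⟨ sumℚ-++ (map f (upTo K)) (f K ∷ []) ⟩
  sumℚ (map f (upTo K)) + (f K + 0ℚ)     ≡⟨ cong (_+_ (sumℚ (map f (upTo K)))) (ℚP.+-identityʳ (f K)) ⟩
  sumℚ (map f (upTo K)) + f K            ∎
  where open ≡-Reasoning

length-allFin : ∀ k → length (allFin k) ≡ k
length-allFin k = length-tabulate {n = k} (λ i → i)

module _ {A : Set} where

  sumℚ-map-cong-∈ : ∀ {f g : A → ℚ} xs → (∀ a → a ∈ xs → f a ≡ g a) → sumℚ (map f xs) ≡ sumℚ (map g xs)
  sumℚ-map-cong-∈ []       f≡g = refl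
  sumℚ-map-cong-∈ (a ∷ xs) f≡g = cong₂ _+_ (f≡g a (here refl)) (sumℚ-map-cong-∈ xs (λ b b∈ → f≡g b (there b∈)))

  sumℚ-map-cong : ∀ {f g : A → ℚ} xs → (∀ a → f a ≡ g a) → sumℚ (map f xs) ≡ sumℚ (map g xs)
  sumℚ-map-cong xs f≡g = sumℚ-map-cong-∈ xs (λ a _ → f≡g a)

  sumℚ-map-mono-∈ : ∀ {f g : A → ℚ} xs → (∀ a → a ∈ xs → f a ≤ g a) → sumℚ (map f xs) ≤ sumℚ (map g xs)
  sumℚ-map-mono-∈ []       f≤g = ℚP.≤-refl
  sumℚ-map-mono-∈ (a ∷ xs) f≤g = ℚP.+-mono-≤ (f≤g a (here refl)) (sumℚ-map-mono-∈ xs (λ b b∈ → f≤g b (there b∈)))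

  sumℚ-map-mono : ∀ {f g : A → ℚ} xs → (∀ a → f a ≤ g a) → sumℚ (map f xs) ≤ sumℚ (map g xs)
  sumℚ-map-mono xs f≤g = sumℚ-map-mono-∈ xs (λ a _ → f≤g a)

  sumℚ-map-+ : ∀ (f g : A → ℚ) xs → sumℚ (map (λ a → f a + g a) xs) ≡ sumℚ (map f xs) + sumℚ (map g xs)
  sumℚ-map-+ f g []       = refl
  sumℚ-map-+ f g (a ∷ xs) = trans (cong (_+_ (f a + g a)) (sumℚ-map-+ f g xs))
    (solve 4 (λ x y z w → (x :+ y) :+ (z :+ w) := (x :+ z) :+ (y :+ w)) refl (f a) (g a) _ _)

  sumℚ-map-*ˡ : ∀ c (f : A → ℚ) xs → sumℚ (map (λ a → c * f a) xs) ≡ c * sumℚ (map f xs)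
  sumℚ-map-*ˡ c f []       = sym (ℚP.*-zeroʳ c)
  sumℚ-map-*ˡ c f (a ∷ xs) = trans (cong (_+_ (c * f a)) (sumℚ-map-*ˡ c f xs)) (sym (ℚP.*-distribˡ-+ c _ _))

  sumℚ-map-const : ∀ c (xs : List A) → sumℚ (map (λ _ → c) xs) ≡ fromℕ (length xs) * c
  sumℚ-map-const c []       = sym (ℚP.*-zeroˡ c)
  sumℚ-map-const c (a ∷ xs) = begin
    c + sumℚ (map (λ _ → c) xs)    ≡⟨ cong (_+_ c) (sumℚ-map-const c xs) ⟩
    c + fromℕ (length xs) * c      ≡⟨ solve 2 (λ c l → c :+ l :* c := (con 1ℚ :+ l) :* c) refl c (fromℕ (length xs)) ⟩
    (1ℚ + fromℕ (length xs)) * c   ≡⟨ cong (_* c) (fromℕ-+ 1 (length xs)) ⟨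
    fromℕ (suc (length xs)) * c    ∎
    where open ≡-Reasoning

  sumℚ-map-≤-const : ∀ {c} {f : A → ℚ} xs → (∀ a → f a ≤ c) → sumℚ (map f xs) ≤ fromℕ (length xs) * c
  sumℚ-map-≤-const {c} xs f≤c = ℚP.≤-trans (sumℚ-map-mono xs f≤c) (ℚP.≤-reflexive (sumℚ-map-const c xs))

  sumℚ-map-nonNeg : ∀ {f : A → ℚ} xs → (∀ a → 0ℚ ≤ f a) → 0ℚ ≤ sumℚ (map f xs)
  sumℚ-map-nonNeg {f} xs 0≤f = subst (_≤ sumℚ (map f xs))
    (trans (sumℚ-map-const 0ℚ xs) (ℚP.*-zeroʳ (fromℕ (length xs)))) (sumℚ-map-mono xs 0≤f)

  ∈⇒≤sumℚ-map : ∀ {f : A → ℚ} {a} xs → (∀ b → 0ℚ ≤ f b) → a ∈ xs → f a ≤ sumℚ (map f xs)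
  ∈⇒≤sumℚ-map {f} {a} (a ∷ xs) 0≤f (here refl) =
    subst (_≤ f a + sumℚ (map f xs)) (ℚP.+-identityʳ (f a)) (ℚP.+-monoʳ-≤ (f a) (sumℚ-map-nonNeg xs 0≤f))
  ∈⇒≤sumℚ-map {f} {a} (b ∷ xs) 0≤f (there a∈xs) =
    subst (_≤ f b + sumℚ (map f xs)) (ℚP.+-identityˡ (f a)) (ℚP.+-mono-≤ (0≤f b) (∈⇒≤sumℚ-map xs 0≤f a∈xs))

  sumℚ-map-fromℕ : ∀ {f : A → ℚ} xs → (∀ a → a ∈ xs → Σ ℕ λ z → f a ≡ fromℕ z) →
                   Σ ℕ λ z → sumℚ (map f xs) ≡ fromℕ z
  sumℚ-map-fromℕ []       f∈ℕ = 0 , refl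
  sumℚ-map-fromℕ (a ∷ xs) f∈ℕ with f∈ℕ a (here refl) | sumℚ-map-fromℕ xs (λ b b∈ → f∈ℕ b (there b∈))
  ... | z , fa≡z | w , Σ≡w = z ℕ.+ w , trans (cong₂ _+_ fa≡z Σ≡w) (sym (fromℕ-+ z w))

  sumℚ-map-filter : ∀ {P : A → Set} (P? : ∀ a → Dec (P a)) (f : A → ℚ) xs →
    sumℚ (map f (filter P? xs)) ≡ sumℚ (map (λ a → if does (P? a) then f a else 0ℚ) xs)
  sumℚ-map-filter P? f [] = refl
  sumℚ-map-filter P? f (a ∷ xs) with does (P? a)
  ... | true  = cong (_+_ (f a)) (sumℚ-map-filter P? f xs)
  ... | false = trans (sumℚ-map-filter P? f xs) (sym (ℚP.+-identityˡ _))

module _ {A B : Set} where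

  sumℚ-map-swap : ∀ (f : A → B → ℚ) xs ys →
    sumℚ (map (λ a → sumℚ (map (f a) ys)) xs) ≡ sumℚ (map (λ b → sumℚ (map (λ a → f a b) xs)) ys)
  sumℚ-map-swap f []       ys = sym (trans (sumℚ-map-const 0ℚ ys) (ℚP.*-zeroʳ (fromℕ (length ys))))
  sumℚ-map-swap f (a ∷ xs) ys = trans (cong (_+_ (sumℚ (map (f a) ys))) (sumℚ-map-swap f xs ys))
    (sym (sumℚ-map-+ (f a) (λ b → sumℚ (map (λ a′ → f a′ b) xs)) ys))

module _ {V : Set} (_≟_ : DecidableEquality V) where

  indicator : V → V → ℚ → ℚ
  indicator v u q = if does (v ≟ u) then q else 0ℚ

  sumℚ-indicator-∉ : ∀ {v} q us → v ∉ us → sumℚ (map (λ u → indicator v u q) us) ≡ 0ℚ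
  sumℚ-indicator-∉ {v} q []       v∉ = refl
  sumℚ-indicator-∉ {v} q (u ∷ us) v∉ with v ≟ u
  ... | yes v≡u = contradiction (here v≡u) v∉
  ... | no  _   = trans (ℚP.+-identityˡ _) (sumℚ-indicator-∉ q us (λ v∈ → v∉ (there v∈)))

  sumℚ-indicator-∈ : ∀ {v} q us → Unique us → v ∈ us → sumℚ (map (λ u → indicator v u q) us) ≡ q
  sumℚ-indicator-∈ {v} q (u ∷ us) (u∉us ∷ uniq) v∈ with v ≟ u | v∈
  ... | yes refl | _          = trans (cong (_+_ q) (sumℚ-indicator-∉ q us (All¬⇒¬Any u∉us))) (ℚP.+-identityʳ q)
  ... | no  v≢u  | here v≡u   = contradiction v≡u v≢u
  ... | no  _    | there v∈us = trans (ℚP.+-identityˡ _) (sumℚ-indicator-∈ q us uniq v∈us)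

  sumℚ-fibres : ∀ {A : Set} (key : A → V) (f : A → ℚ) xs us →
    sumℚ (map (λ u → sumℚ (map f (filter (λ a → key a ≟ u) xs))) us) ≡
    sumℚ (map (λ a → sumℚ (map (λ u → indicator (key a) u (f a)) us)) xs)
  sumℚ-fibres key f xs us = trans (sumℚ-map-cong us (λ u → sumℚ-map-filter (λ a → key a ≟ u) f xs))
    (sumℚ-map-swap (λ u a → indicator (key a) u (f a)) us xs)

  sumℚ-fibres-partition : ∀ {A : Set} (key : A → V) (f : A → ℚ) xs {us ws} → Unique us → Unique ws →
    (∀ a → (key a ∈ us × key a ∉ ws) ⊎ (key a ∉ us × key a ∈ ws)) →
    sumℚ (map (λ u → sumℚ (map f (filter (λ a → key a ≟ u) xs))) us) +
    sumℚ (map (λ w → sumℚ (map f (filter (λ a → key a ≟ w) xs))) ws) ≡ sumℚ (map f xs)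
  sumℚ-fibres-partition {A} key f xs {us} {ws} uniq-us uniq-ws exactly-one = begin
    fibres us + fibres ws         ≡⟨ cong₂ _+_ (sumℚ-fibres key f xs us) (sumℚ-fibres key f xs ws) ⟩
    sumℚ (map (count us) xs) + sumℚ (map (count ws) xs) ≡⟨ sumℚ-map-+ (count us) (count ws) xs ⟨
    sumℚ (map (λ a → count us a + count ws a) xs)       ≡⟨ sumℚ-map-cong xs counts ⟩
    sumℚ (map f xs)               ∎
    where
    open ≡-Reasoning
    fibres : List V → ℚ
    fibres vs = sumℚ (map (λ u → sumℚ (map f (filter (λ a → key a ≟ u) xs))) vs)
    count : List V → A → ℚ
    count vs a = sumℚ (map (λ u → indicator (key a) u (f a)) vs)
    counts : ∀ a → count us a + count ws a ≡ f a
    counts a with exactly-one a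
    ... | inj₁ (∈us , ∉ws) = trans (cong₂ _+_ (sumℚ-indicator-∈ (f a) us uniq-us ∈us) (sumℚ-indicator-∉ (f a) ws ∉ws))
                                   (ℚP.+-identityʳ (f a))
    ... | inj₂ (∉us , ∈ws) = trans (cong₂ _+_ (sumℚ-indicator-∉ (f a) us ∉us) (sumℚ-indicator-∈ (f a) ws uniq-ws ∈ws))
                                   (ℚP.+-identityˡ (f a))

private
  2ᵏ≢0 : ∀ k → NonZero (2 ^ k)
  2ᵏ≢0 k = ℕP.m^n≢0 2 k

½ᵏ : ℕ → ℚ
½ᵏ k = (+ 1 / 2 ^ k) {{2ᵏ≢0 k}}

½ᵏ-nonNeg : ∀ k → 0ℚ ≤ ½ᵏ k
½ᵏ-nonNeg k = 1/-nonNeg (2 ^ k) {{2ᵏ≢0 k}}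

½ᵏ*2ᵏ≡1 : ∀ k → ½ᵏ k * fromℕ (2 ^ k) ≡ 1ℚ
½ᵏ*2ᵏ≡1 k = 1/d*d≡1 (2 ^ k) {{2ᵏ≢0 k}}

2*½ᵏ⁺¹≡½ᵏ : ∀ k → fromℕ 2 * ½ᵏ (suc k) ≡ ½ᵏ k
2*½ᵏ⁺¹≡½ᵏ k = y*d≡1⇒y≡1/d (2 ^ k) {{2ᵏ≢0 k}} (begin
  fromℕ 2 * ½ᵏ (suc k) * fromℕ (2 ^ k)   ≡⟨ solve 3 (λ a b c → (a :* b) :* c := b :* (a :* c)) refl (fromℕ 2) (½ᵏ (suc k)) (fromℕ (2 ^ k)) ⟩
  ½ᵏ (suc k) * (fromℕ 2 * fromℕ (2 ^ k)) ≡⟨ cong (½ᵏ (suc k) *_) (fromℕ-* 2 (2 ^ k)) ⟨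
  ½ᵏ (suc k) * fromℕ (2 ^ suc k)         ≡⟨ ½ᵏ*2ᵏ≡1 (suc k) ⟩
  1ℚ                                     ∎)
  where open ≡-Reasoning

*2ᵏ≡⇒≡*½ᵏ : ∀ k z {y} → y * fromℕ (2 ^ k) ≡ fromℕ z → y ≡ fromℕ z * ½ᵏ k
*2ᵏ≡⇒≡*½ᵏ k z {y} y2ᵏ≡z = begin
  y                             ≡⟨ ℚP.*-identityʳ y ⟨
  y * 1ℚ                        ≡⟨ cong (y *_) (trans (ℚP.*-comm (fromℕ (2 ^ k)) (½ᵏ k)) (½ᵏ*2ᵏ≡1 k)) ⟨
  y * (fromℕ (2 ^ k) * ½ᵏ k)    ≡⟨ ℚP.*-assoc y (fromℕ (2 ^ k)) (½ᵏ k) ⟨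
  y * fromℕ (2 ^ k) * ½ᵏ k      ≡⟨ cong (_* ½ᵏ k) y2ᵏ≡z ⟩
  fromℕ z * ½ᵏ k                ∎
  where open ≡-Reasoning

module BinaryExpansion (x : ℚ) (0≤x : 0ℚ ≤ x) where

  2ᵏx : ℕ → ℚ
  2ᵏx k = fromℕ (2 ^ k) * x

  2ᵏx-nonNeg : ∀ k → 0ℚ ≤ 2ᵏx k
  2ᵏx-nonNeg k = *-nonNeg (fromℕ-nonNeg (2 ^ k)) 0≤x

  2ᵏ⁺¹x≡2*2ᵏx : ∀ k → 2ᵏx (suc k) ≡ fromℕ 2 * 2ᵏx k
  2ᵏ⁺¹x≡2*2ᵏx k = trans (cong (_* x) (fromℕ-* 2 (2 ^ k))) (ℚP.*-assoc (fromℕ 2) (fromℕ (2 ^ k)) x)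

  truncation : ℕ → ℚ
  truncation k = fromℕ ⌊ 2ᵏx k ⌋ℕ * ½ᵏ k

  truncation≤x : ∀ k → truncation k ≤ x
  truncation≤x k = begin
    fromℕ ⌊ 2ᵏx k ⌋ℕ * ½ᵏ k       ≤⟨ *-monoʳ-≤-nonNeg (½ᵏ-nonNeg k) (⌊⌋ℕ≤ (2ᵏx-nonNeg k)) ⟩
    fromℕ (2 ^ k) * x * ½ᵏ k      ≡⟨ solve 3 (λ a b c → (a :* b) :* c := b :* (c :* a)) refl (fromℕ (2 ^ k)) x (½ᵏ k) ⟩
    x * (½ᵏ k * fromℕ (2 ^ k))    ≡⟨ cong (x *_) (½ᵏ*2ᵏ≡1 k) ⟩
    x * 1ℚ                        ≡⟨ ℚP.*-identityʳ x ⟩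
    x                             ∎
    where open ℚP.≤-Reasoning

  ≤x⇒≤truncation : ∀ k z → fromℕ z * ½ᵏ k ≤ x → fromℕ z * ½ᵏ k ≤ truncation k
  ≤x⇒≤truncation k z z½ᵏ≤x = *-monoʳ-≤-nonNeg (½ᵏ-nonNeg k) (fromℕ-mono-≤ (≤⌊⌋ℕ {z = z} (2ᵏx-nonNeg k) (begin
    fromℕ z                          ≡⟨ ℚP.*-identityʳ (fromℕ z) ⟨
    fromℕ z * 1ℚ                     ≡⟨ cong (fromℕ z *_) (½ᵏ*2ᵏ≡1 k) ⟨
    fromℕ z * (½ᵏ k * fromℕ (2 ^ k)) ≡⟨ ℚP.*-assoc (fromℕ z) (½ᵏ k) _ ⟨
    fromℕ z * ½ᵏ k * fromℕ (2 ^ k)   ≤⟨ *-monoʳ-≤-nonNeg (fromℕ-nonNeg (2 ^ k)) z½ᵏ≤x ⟩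
    x * fromℕ (2 ^ k)                ≡⟨ ℚP.*-comm x _ ⟩
    2ᵏx k                            ∎)))
    where open ℚP.≤-Reasoning

  ⌊2ᵏ⁺¹x⌋≡digit+2⌊2ᵏx⌋ : ∀ k → ⌊ 2ᵏx (suc k) ⌋ℕ ≡ binDigit (suc k) x ℕ.+ ⌊ 2ᵏx k ⌋ℕ ℕ.* 2
  ⌊2ᵏ⁺¹x⌋≡digit+2⌊2ᵏx⌋ k = trans (sym r+2c≡c′) (cong (ℕ._+ c ℕ.* 2) (sym digit≡r))
    where
    c c′ : ℕ
    c  = ⌊ 2ᵏx k ⌋ℕ
    c′ = ⌊ 2ᵏx (suc k) ⌋ℕ
    2c≤c′ : c ℕ.* 2 ℕ.≤ c′
    2c≤c′ = ≤⌊⌋ℕ {z = c ℕ.* 2} (2ᵏx-nonNeg (suc k)) (begin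
      fromℕ (c ℕ.* 2)     ≡⟨ fromℕ-* c 2 ⟩
      fromℕ c * fromℕ 2   ≤⟨ *-monoʳ-≤-nonNeg (fromℕ-nonNeg 2) (⌊⌋ℕ≤ (2ᵏx-nonNeg k)) ⟩
      2ᵏx k * fromℕ 2     ≡⟨ ℚP.*-comm (2ᵏx k) (fromℕ 2) ⟩
      fromℕ 2 * 2ᵏx k     ≡⟨ 2ᵏ⁺¹x≡2*2ᵏx k ⟨
      2ᵏx (suc k)         ∎)
      where open ℚP.≤-Reasoning
    c′<2c+2 : c′ ℕ.< c ℕ.* 2 ℕ.+ 2
    c′<2c+2 = fromℕ-cancel-< (begin-strict
      fromℕ c′                  ≤⟨ ⌊⌋ℕ≤ (2ᵏx-nonNeg (suc k)) ⟩
      2ᵏx (suc k)               ≡⟨ 2ᵏ⁺¹x≡2*2ᵏx k ⟩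
      fromℕ 2 * 2ᵏx k           <⟨ ℚP.*-monoʳ-<-pos (fromℕ 2) {{_}} (<1+⌊⌋ℕ (2ᵏx-nonNeg k)) ⟩
      fromℕ 2 * fromℕ (suc c)   ≡⟨ fromℕ-* 2 (suc c) ⟨
      fromℕ (2 ℕ.* suc c)       ≡⟨ cong fromℕ (trans (ℕP.*-comm 2 (suc c)) (ℕP.+-comm 2 (c ℕ.* 2))) ⟩
      fromℕ (c ℕ.* 2 ℕ.+ 2)     ∎)
      where open ℚP.≤-Reasoning
    r : ℕ
    r = c′ ℕ.∸ c ℕ.* 2
    r+2c≡c′ : r ℕ.+ c ℕ.* 2 ≡ c′
    r+2c≡c′ = ℕP.m∸n+n≡m 2c≤c′
    digit≡r : binDigit (suc k) x ≡ r
    digit≡r = trans (cong (ℕ._% 2) (sym r+2c≡c′))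
      (trans (ℕD.[m+kn]%n≡m%n r c 2) (ℕD.m<n⇒m%n≡m (ℕP.m<n+o⇒m∸n<o c′ (c ℕ.* 2) c′<2c+2)))

  truncation-suc : ∀ k → truncation (suc k) ≡ truncation k + fromℕ (binDigit (suc k) x) * ½ᵏ (suc k)
  truncation-suc k = begin
    fromℕ ⌊ 2ᵏx (suc k) ⌋ℕ * ½ᵏ (suc k)        ≡⟨ cong (λ z → fromℕ z * ½ᵏ (suc k)) (⌊2ᵏ⁺¹x⌋≡digit+2⌊2ᵏx⌋ k) ⟩
    fromℕ (b ℕ.+ c ℕ.* 2) * ½ᵏ (suc k)          ≡⟨ cong (_* ½ᵏ (suc k)) (trans (fromℕ-+ b (c ℕ.* 2)) (cong (_+_ (fromℕ b)) (fromℕ-* c 2))) ⟩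
    (fromℕ b + fromℕ c * fromℕ 2) * ½ᵏ (suc k)  ≡⟨ solve 4 (λ B C t w → (B :+ C :* t) :* w := C :* (t :* w) :+ B :* w) refl
                                                     (fromℕ b) (fromℕ c) (fromℕ 2) (½ᵏ (suc k)) ⟩
    fromℕ c * (fromℕ 2 * ½ᵏ (suc k)) + fromℕ b * ½ᵏ (suc k) ≡⟨ cong (λ z → fromℕ c * z + fromℕ b * ½ᵏ (suc k)) (2*½ᵏ⁺¹≡½ᵏ k) ⟩
    truncation k + fromℕ b * ½ᵏ (suc k)        ∎
    where
    open ≡-Reasoning
    b c : ℕ
    b = binDigit (suc k) x
    c = ⌊ 2ᵏx k ⌋ℕ

  digitTerm : ℕ → ℚ
  digitTerm k = (+ (k ℕ.* binDigit k x) / 2 ^ k) {{2ᵏ≢0 k}}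

  digitTerm≡ : ∀ k → digitTerm k ≡ fromℕ k * (fromℕ (binDigit k x) * ½ᵏ k)
  digitTerm≡ k = trans (/≡fromℕ*1/ (k ℕ.* binDigit k x) (2 ^ k) {{2ᵏ≢0 k}})
    (trans (cong (_* ½ᵏ k) (fromℕ-* k (binDigit k x))) (ℚP.*-assoc (fromℕ k) _ (½ᵏ k)))

  digitTerm-nonNeg : ∀ k → 0ℚ ≤ digitTerm k
  digitTerm-nonNeg k = subst (0ℚ ≤_) (sym (digitTerm≡ k))
    (*-nonNeg (fromℕ-nonNeg k) (*-nonNeg (fromℕ-nonNeg (binDigit k x)) (½ᵏ-nonNeg k)))

  truncationDefect : ℕ → ℚ
  truncationDefect K = sumℚ (map (λ k → x - truncation k) (upTo K))

  -- x - truncation k = Σ_{j > k} b_j 2⁻ʲ, so the defect weighs the j-th digit by min(j, K).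
  truncationDefect≡ : ∀ K → truncationDefect K ≡ digitSum (suc K) x + fromℕ K * (x - truncation K)
  truncationDefect≡ zero = sym (trans
    (cong₂ _+_ (trans (ℚP.+-identityʳ (digitTerm 0)) (trans (digitTerm≡ 0) (ℚP.*-zeroˡ (fromℕ (binDigit 0 x) * ½ᵏ 0))))
               (ℚP.*-zeroˡ (x - truncation 0)))
    (ℚP.+-identityʳ 0ℚ))
  truncationDefect≡ (suc K) = begin
    truncationDefect (suc K)                       ≡⟨ sumℚ-upTo-suc (λ k → x - truncation k) K ⟩
    truncationDefect K + (x - truncation K)        ≡⟨ cong (_+ (x - truncation K)) (truncationDefect≡ K) ⟩
    D + fromℕ K * (x - truncation K) + (x - truncation K)
      ≡⟨ cong (λ z → D + fromℕ K * (x - z) + (x - z)) truncation≡ ⟩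
    D + fromℕ K * (x - (t′ - β)) + (x - (t′ - β))
      ≡⟨ solve 5 (λ D k x t′ β → D :+ k :* (x :- (t′ :- β)) :+ (x :- (t′ :- β)) := (D :+ (con 1ℚ :+ k) :* β) :+ (con 1ℚ :+ k) :* (x :- t′))
               refl D (fromℕ K) x t′ β ⟩
    (D + (1ℚ + fromℕ K) * β) + (1ℚ + fromℕ K) * (x - t′)
      ≡⟨ cong₂ (λ u v → (D + u) + v * (x - t′)) (trans (cong (_* β) (sym (fromℕ-+ 1 K))) (sym (digitTerm≡ (suc K)))) (sym (fromℕ-+ 1 K)) ⟩
    (D + digitTerm (suc K)) + fromℕ (suc K) * (x - t′) ≡⟨ cong (_+ fromℕ (suc K) * (x - t′)) (sumℚ-upTo-suc digitTerm (suc K)) ⟨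
    digitSum (suc (suc K)) x + fromℕ (suc K) * (x - t′) ∎
    where
    open ≡-Reasoning
    D t′ β : ℚ
    D  = digitSum (suc K) x
    t′ = truncation (suc K)
    β  = fromℕ (binDigit (suc K) x) * ½ᵏ (suc K)
    truncation≡ : truncation K ≡ t′ - β
    truncation≡ = trans (solve 2 (λ a b → a := (a :+ b) :- b) refl (truncation K) β) (cong (_- β) (sym (truncation-suc K)))

  digitSum≤truncationDefect : ∀ K → digitSum K x ≤ truncationDefect K
  digitSum≤truncationDefect K = begin
    digitSum K x                                ≤⟨ ≤+nonNeg (digitTerm-nonNeg K) ⟩
    digitSum K x + digitTerm K                  ≡⟨ sumℚ-upTo-suc digitTerm K ⟨
    digitSum (suc K) x                          ≤⟨ ≤+nonNeg (*-nonNeg (fromℕ-nonNeg K) (p≤q⇒0≤q-p (truncation≤x K))) ⟩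
    digitSum (suc K) x + fromℕ K * (x - truncation K) ≡⟨ truncationDefect≡ K ⟨
    truncationDefect K                          ∎
    where
    open ℚP.≤-Reasoning
    ≤+nonNeg : ∀ {a c} → 0ℚ ≤ c → a ≤ a + c
    ≤+nonNeg {a} {c} 0≤c = subst (_≤ a + c) (ℚP.+-identityʳ a) (ℚP.+-monoʳ-≤ a 0≤c)

private
  length≡1⇒singleton : ∀ {A : Set} (xs : List A) → length xs ≡ 1 → Σ A λ a → xs ≡ a ∷ []
  length≡1⇒singleton (a ∷ []) refl = a , refl

  length≡2⇒pair : ∀ {A : Set} (xs : List A) → length xs ≡ 2 → Unique xs →
                  Σ A λ a → Σ A λ b → xs ≡ a ∷ b ∷ [] × a ≢ b
  length≡2⇒pair (a ∷ b ∷ []) refl ((a≢b ∷ []) ∷ _) = a , b , refl , a≢b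

  ∉-map : ∀ {A B : Set} {f : A → B} {b} xs → (∀ a → b ≢ f a) → b ∉ map f xs
  ∉-map xs b≢f b∈ with ∈-map⁻ _ b∈
  ... | a , _ , b≡fa = b≢f a b≡fa

module Network {n s p} (G : SplitterNetwork n s p) where

  Arc : Set
  Arc = Fin (m G)

  tail∈δ⁺ : ∀ {e v} → tail G e ≡ v → e ∈ δ⁺ G v
  tail∈δ⁺ {e} {v} = ∈-filter⁺ (λ a → tail G a ≟V v) (∈-allFin e)

  head∈δ⁻ : ∀ {e v} → head G e ≡ v → e ∈ δ⁻ G v
  head∈δ⁻ {e} {v} = ∈-filter⁺ (λ a → head G a ≟V v) (∈-allFin e)

  ∈δ⁺⇒tail : ∀ {e v} → e ∈ δ⁺ G v → tail G e ≡ v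
  ∈δ⁺⇒tail {e} {v} e∈ = proj₂ (∈-filter⁻ (λ a → tail G a ≟V v) {xs = allFin (m G)} e∈)

  ∈δ⁻⇒head : ∀ {e v} → e ∈ δ⁻ G v → head G e ≡ v
  ∈δ⁻⇒head {e} {v} e∈ = proj₂ (∈-filter⁻ (λ a → head G a ≟V v) {xs = allFin (m G)} e∈)

  δ⁺-unique : ∀ v → Unique (δ⁺ G v)
  δ⁺-unique v = Unique.filter⁺ (λ a → tail G a ≟V v) (Unique.allFin⁺ (m G))

  head≢input : ∀ e i → head G e ≢ inV i
  head≢input e i eq with δ⁻ G (inV i) | in-in G i | head∈δ⁻ eq
  ... | [] | _ | ()

  tail≢output : ∀ e o → tail G e ≢ outV o
  tail≢output e o eq with δ⁺ G (outV o) | out-out G o | tail∈δ⁺ eq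
  ... | [] | _ | ()

  inArc : Fin n → Arc
  inArc i = proj₁ (length≡1⇒singleton (δ⁺ G (inV i)) (in-out G i))

  δ⁺-input : ∀ i → δ⁺ G (inV i) ≡ inArc i ∷ []
  δ⁺-input i = proj₂ (length≡1⇒singleton (δ⁺ G (inV i)) (in-out G i))

  tail-inArc : ∀ i → tail G (inArc i) ≡ inV i
  tail-inArc i = ∈δ⁺⇒tail (subst (inArc i ∈_) (sym (δ⁺-input i)) (here refl))

  sumℚ-δ⁺-input : ∀ (f : Arc → ℚ) i → sumℚ (map f (δ⁺ G (inV i))) ≡ f (inArc i)
  sumℚ-δ⁺-input f i = trans (cong (λ es → sumℚ (map f es)) (δ⁺-input i)) (ℚP.+-identityʳ (f (inArc i)))

  outArc : Fin p → Arc
  outArc o = proj₁ (length≡1⇒singleton (δ⁻ G (outV o)) (out-in G o))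

  δ⁻-output : ∀ o → δ⁻ G (outV o) ≡ outArc o ∷ []
  δ⁻-output o = proj₂ (length≡1⇒singleton (δ⁻ G (outV o)) (out-in G o))

  head-outArc : ∀ o → head G (outArc o) ≡ outV o
  head-outArc o = ∈δ⁻⇒head (subst (outArc o ∈_) (sym (δ⁻-output o)) (here refl))

  sumℚ-δ⁻-output : ∀ (f : Arc → ℚ) o → sumℚ (map f (δ⁻ G (outV o))) ≡ f (outArc o)
  sumℚ-δ⁻-output f o = trans (cong (λ es → sumℚ (map f es)) (δ⁻-output o)) (ℚP.+-identityʳ (f (outArc o)))

  private
    sumℚ-pair : ∀ {es a b} (f : Arc → ℚ) → es ≡ a ∷ b ∷ [] → sumℚ (map f es) ≡ f a + f b
    sumℚ-pair {a = a} {b} f refl = cong (_+_ (f a)) (ℚP.+-identityʳ (f b))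

  sibling : ∀ {x e} → tail G e ≡ spV x →
            Σ Arc λ e′ → e ≢ e′ × tail G e′ ≡ spV x × (∀ (f : Arc → ℚ) → sumℚ (map f (δ⁺ G (spV x))) ≡ f e + f e′)
  sibling {x} {e} tail≡x with length≡2⇒pair (δ⁺ G (spV x)) (sp-out G x) (δ⁺-unique (spV x))
  ... | a , b , δ⁺≡ab , a≢b with subst (e ∈_) δ⁺≡ab (tail∈δ⁺ tail≡x)
  ... | here refl =
    b , a≢b , ∈δ⁺⇒tail (subst (b ∈_) (sym δ⁺≡ab) (there (here refl))) , λ f → sumℚ-pair f δ⁺≡ab
  ... | there (here refl) =
    a , (λ b≡a → a≢b (sym b≡a)) , ∈δ⁺⇒tail (subst (a ∈_) (sym δ⁺≡ab) (here refl)) ,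
    λ f → trans (sumℚ-pair f δ⁺≡ab) (ℚP.+-comm (f a) (f b))

  inputs : List (Vertex n s p)
  inputs = map inV (allFin n)

  splitters : List (Vertex n s p)
  splitters = map spV (allFin s)

  outputs : List (Vertex n s p)
  outputs = map outV (allFin p)

  inflow outflow : (Arc → ℚ) → Vertex n s p → ℚ
  inflow  f v = sumℚ (map f (δ⁻ G v))
  outflow f v = sumℚ (map f (δ⁺ G v))

  ΣI⁺ ΣS⁺ ΣS⁻ ΣO⁻ : (Arc → ℚ) → ℚ
  ΣI⁺ f = sumℚ (map (λ i → outflow f (inV i)) (allFin n))
  ΣS⁺ f = sumℚ (map (λ x → outflow f (spV x)) (allFin s))
  ΣS⁻ f = sumℚ (map (λ x → inflow f (spV x)) (allFin s))
  ΣO⁻ f = sumℚ (map (λ o → inflow f (outV o)) (allFin p))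

  private
    head-in-splitters-or-outputs : ∀ e → (head G e ∈ splitters × head G e ∉ outputs) ⊎ (head G e ∉ splitters × head G e ∈ outputs)
    head-in-splitters-or-outputs e with head G e in eq
    ... | inj₁ i        = contradiction eq (head≢input e i)
    ... | inj₂ (inj₁ x) = inj₁ (∈-map⁺ spV (∈-allFin x) , ∉-map (allFin p) (λ _ ()))
    ... | inj₂ (inj₂ o) = inj₂ (∉-map (allFin s) (λ _ ()) , ∈-map⁺ outV (∈-allFin o))

    tail-in-inputs-or-splitters : ∀ e → (tail G e ∈ inputs × tail G e ∉ splitters) ⊎ (tail G e ∉ inputs × tail G e ∈ splitters)
    tail-in-inputs-or-splitters e with tail G e in eq
    ... | inj₁ i        = inj₁ (∈-map⁺ inV (∈-allFin i) , ∉-map (allFin s) (λ _ ()))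
    ... | inj₂ (inj₁ x) = inj₂ (∉-map (allFin n) (λ _ ()) , ∈-map⁺ spV (∈-allFin x))
    ... | inj₂ (inj₂ o) = contradiction eq (tail≢output e o)

    unique-map : ∀ {k} {f : Fin k → Vertex n s p} → (∀ {a b} → f a ≡ f b → a ≡ b) → Unique (map f (allFin k))
    unique-map {k} f-inj = Unique.map⁺ f-inj (Unique.allFin⁺ k)

  handshake : ∀ f → ΣS⁻ f + ΣO⁻ f ≡ ΣI⁺ f + ΣS⁺ f
  handshake f = begin
    ΣS⁻ f + ΣO⁻ f
      ≡⟨ cong₂ _+_ (cong sumℚ (map-∘ (allFin s))) (cong sumℚ (map-∘ (allFin p))) ⟩
    sumℚ (map (inflow f) splitters) + sumℚ (map (inflow f) outputs)
      ≡⟨ sumℚ-fibres-partition _≟V_ (head G) f (allFin (m G))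
           (unique-map (λ eq → inj₁-injective (inj₂-injective eq))) (unique-map (λ eq → inj₂-injective (inj₂-injective eq)))
           head-in-splitters-or-outputs ⟩
    sumℚ (map f (allFin (m G)))
      ≡⟨ sumℚ-fibres-partition _≟V_ (tail G) f (allFin (m G))
           (unique-map inj₁-injective) (unique-map (λ eq → inj₁-injective (inj₂-injective eq)))
           tail-in-inputs-or-splitters ⟨
    sumℚ (map (outflow f) inputs) + sumℚ (map (outflow f) splitters)
      ≡⟨ cong₂ _+_ (cong sumℚ (map-∘ (allFin n))) (cong sumℚ (map-∘ (allFin s))) ⟨
    ΣI⁺ f + ΣS⁺ f ∎
    where open ≡-Reasoning

  ΣS⁻≤2s : ∀ {f : Arc → ℚ} → (∀ e → f e ≤ 1ℚ) → ΣS⁻ f ≤ fromℕ s * fromℕ 2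
  ΣS⁻≤2s {f} f≤1 = begin
    ΣS⁻ f                                      ≤⟨ sumℚ-map-mono (allFin s) inflow≤2 ⟩
    sumℚ (map (λ _ → fromℕ 2) (allFin s))     ≡⟨ sumℚ-map-const (fromℕ 2) (allFin s) ⟩
    fromℕ (length (allFin s)) * fromℕ 2       ≡⟨ cong (λ k → fromℕ k * fromℕ 2) (length-allFin s) ⟩
    fromℕ s * fromℕ 2                          ∎
    where
    open ℚP.≤-Reasoning
    inflow≤2 : ∀ x → inflow f (spV x) ≤ fromℕ 2
    inflow≤2 x = subst (λ c → inflow f (spV x) ≤ c) (trans (cong (λ d → fromℕ d * 1ℚ) (sp-in G x)) (ℚP.*-identityʳ (fromℕ 2)))
                       (sumℚ-map-≤-const (δ⁻ G (spV x)) f≤1)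

  throughput-conservation : ∀ {cI cO t F} → IsSteadyState G cI cO t F → ΣO⁻ t ≡ ΣI⁺ t
  throughput-conservation {t = t} steady = ∙-cancelˡ (ΣS⁻ t) (ΣO⁻ t) (ΣI⁺ t) (begin
    ΣS⁻ t + ΣO⁻ t   ≡⟨ handshake t ⟩
    ΣI⁺ t + ΣS⁺ t   ≡⟨ ℚP.+-comm (ΣI⁺ t) (ΣS⁺ t) ⟩
    ΣS⁺ t + ΣI⁺ t   ≡⟨ cong (_+ ΣI⁺ t) (sumℚ-map-cong (allFin s) (IsSteadyState.R5 steady)) ⟨
    ΣS⁻ t + ΣI⁺ t   ∎)
    where open ≡-Reasoning

unit : ∀ {n} → Fin n → Fin n → ℚ
unit i j = indicator Fin._≟_ i j 1ℚ

unit-comm : ∀ {n} (i j : Fin n) → unit i j ≡ unit j i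
unit-comm i j with i Fin.≟ j | j Fin.≟ i
... | yes _    | yes _    = refl
... | no  _    | no  _    = refl
... | yes refl | no  i≢i  = contradiction refl i≢i
... | no  i≢i  | yes refl = contradiction refl i≢i

unit-nonNeg : ∀ {n} (i j : Fin n) → 0ℚ ≤ unit i j
unit-nonNeg i j with does (i Fin.≟ j)
... | true  = ℚP.nonNegative⁻¹ 1ℚ
... | false = ℚP.≤-refl

unit≤1 : ∀ {n} (i j : Fin n) → unit i j ≤ 1ℚ
unit≤1 i j with does (i Fin.≟ j)
... | true  = ℚP.≤-refl
... | false = ℚP.nonNegative⁻¹ 1ℚ

sumℚ-unitʳ : ∀ {n} (i : Fin n) → sumℚ (map (unit i) (allFin n)) ≡ 1ℚ
sumℚ-unitʳ {n} i = sumℚ-indicator-∈ Fin._≟_ 1ℚ (allFin n) (Unique.allFin⁺ n) (∈-allFin i)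

sumℚ-unitˡ : ∀ {n} (i : Fin n) → sumℚ (map (λ j → unit j i) (allFin n)) ≡ 1ℚ
sumℚ-unitˡ {n} i = trans (sumℚ-map-cong (allFin n) (λ j → unit-comm j i)) (sumℚ-unitʳ i)

module Commodities {n s p} (G : SplitterNetwork n s p) where

  open Network G

  flow : Fin n → ℕ → Arc → ℚ
  emitted : Fin n → ℕ → Vertex n s p → ℚ
  flow i zero    e = 0ℚ
  flow i (suc K) e = emitted i K (tail G e)
  emitted i K (inj₁ j)        = unit i j
  emitted i K (inj₂ (inj₁ x)) = ½ * inflow (flow i K) (spV x)
  emitted i K (inj₂ (inj₂ o)) = 0ℚ

  flow-nonNeg : ∀ i K e → 0ℚ ≤ flow i K e
  emitted-nonNeg : ∀ i K v → 0ℚ ≤ emitted i K v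
  flow-nonNeg i zero    e = ℚP.≤-refl
  flow-nonNeg i (suc K) e = emitted-nonNeg i K (tail G e)
  emitted-nonNeg i K (inj₁ j)        = unit-nonNeg i j
  emitted-nonNeg i K (inj₂ (inj₁ x)) = *-nonNeg (ℚP.nonNegative⁻¹ ½) (sumℚ-map-nonNeg (δ⁻ G (spV x)) (flow-nonNeg i K))
  emitted-nonNeg i K (inj₂ (inj₂ o)) = ℚP.≤-refl

  flow-dyadic : ∀ i K e → Σ ℕ λ z → flow i (suc K) e * fromℕ (2 ^ K) ≡ fromℕ z
  emitted-dyadic : ∀ i K v → Σ ℕ λ z → emitted i K v * fromℕ (2 ^ K) ≡ fromℕ z
  flow-dyadic i K e = emitted-dyadic i K (tail G e)
  emitted-dyadic i K (inj₁ j) with does (i Fin.≟ j)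
  ... | true  = 2 ^ K , ℚP.*-identityˡ (fromℕ (2 ^ K))
  ... | false = 0 , ℚP.*-zeroˡ (fromℕ (2 ^ K))
  emitted-dyadic i zero (inj₂ (inj₁ x)) =
    0 , trans (ℚP.*-identityʳ _) (cong (½ *_) (trans (sumℚ-map-const 0ℚ (δ⁻ G (spV x))) (ℚP.*-zeroʳ (fromℕ (length (δ⁻ G (spV x)))))))
  emitted-dyadic i (suc K) (inj₂ (inj₁ x))
    with sumℚ-map-fromℕ (δ⁻ G (spV x)) (λ a _ → flow-dyadic i K a)
  ... | z , Σ≡z = z , (begin
    ½ * S * fromℕ (2 ^ suc K)                          ≡⟨ cong (½ * S *_) (fromℕ-* 2 (2 ^ K)) ⟩
    ½ * S * (fromℕ 2 * fromℕ (2 ^ K))                  ≡⟨ solve 2 (λ S u → (con ½ :* S) :* (con (fromℕ 2) :* u) := S :* u) refl S (fromℕ (2 ^ K)) ⟩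
    S * fromℕ (2 ^ K)                                  ≡⟨ ℚP.*-comm S _ ⟩
    fromℕ (2 ^ K) * S                                  ≡⟨ sumℚ-map-*ˡ (fromℕ (2 ^ K)) (flow i (suc K)) (δ⁻ G (spV x)) ⟨
    sumℚ (map (λ a → fromℕ (2 ^ K) * flow i (suc K) a) (δ⁻ G (spV x)))
                                                       ≡⟨ sumℚ-map-cong (δ⁻ G (spV x)) (λ a → ℚP.*-comm (fromℕ (2 ^ K)) (flow i (suc K) a)) ⟩
    sumℚ (map (λ a → flow i (suc K) a * fromℕ (2 ^ K)) (δ⁻ G (spV x))) ≡⟨ Σ≡z ⟩
    fromℕ z                                            ∎)
    where
    open ≡-Reasoning
    S : ℚ
    S = inflow (flow i (suc K)) (spV x)
  emitted-dyadic i K (inj₂ (inj₂ o)) = 0 , ℚP.*-zeroˡ (fromℕ (2 ^ K))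

  flow-recurrence : ∀ i K → ΣS⁻ (flow i (suc K)) + ΣO⁻ (flow i (suc K)) ≡ 1ℚ + ΣS⁻ (flow i K)
  flow-recurrence i K = trans (handshake (flow i (suc K))) (cong₂ _+_ injected forwarded)
    where
    injected : ΣI⁺ (flow i (suc K)) ≡ 1ℚ
    injected = trans (sumℚ-map-cong (allFin n) (λ j → trans (sumℚ-δ⁺-input (flow i (suc K)) j) (cong (emitted i K) (tail-inArc j))))
                     (sumℚ-unitʳ i)
    forwarded : ΣS⁺ (flow i (suc K)) ≡ ΣS⁻ (flow i K)
    forwarded = sumℚ-map-cong (allFin s) λ x → begin
      outflow (flow i (suc K)) (spV x)                              ≡⟨ sumℚ-map-cong-∈ (δ⁺ G (spV x)) (λ e e∈ → cong (emitted i K) (∈δ⁺⇒tail e∈)) ⟩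
      sumℚ (map (λ _ → ½ * inflow (flow i K) (spV x)) (δ⁺ G (spV x))) ≡⟨ sumℚ-map-const _ (δ⁺ G (spV x)) ⟩
      fromℕ (length (δ⁺ G (spV x))) * (½ * inflow (flow i K) (spV x)) ≡⟨ cong (λ d → fromℕ d * (½ * inflow (flow i K) (spV x))) (sp-out G x) ⟩
      fromℕ 2 * (½ * inflow (flow i K) (spV x))                     ≡⟨ solve 1 (λ S → con (fromℕ 2) :* (con ½ :* S) := S) refl (inflow (flow i K) (spV x)) ⟩
      inflow (flow i K) (spV x)                                      ∎
      where open ≡-Reasoning

module AllFluid {n s p} (G : SplitterNetwork n s p)
                (tf : Fin (m G) → ℚ) (fluid : IsSteadyState G (λ _ → 1ℚ) (λ _ → 1ℚ) tf (λ _ → true)) where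

  open Network G
  open Commodities G
  open IsSteadyState fluid

  -- With every arc fluid, R7 applies in both directions to the two out-arcs of a splitter.
  fluid-split : ∀ {x e} → tail G e ≡ spV x → tf e ≡ ½ * inflow tf (spV x)
  fluid-split {x} {e} tail≡x with sibling tail≡x
  ... | e′ , e≢e′ , tail′≡x , outflow≡ = sym (begin
    ½ * inflow tf (spV x)   ≡⟨ cong (½ *_) (trans (R5 x) (outflow≡ tf)) ⟩
    ½ * (tf e + tf e′)      ≡⟨ cong (λ z → ½ * (tf e + z)) (sym tf-e≡tf-e′) ⟩
    ½ * (tf e + tf e)       ≡⟨ solve 1 (λ a → con ½ :* (a :+ a) := a) refl (tf e) ⟩
    tf e                    ∎)
    where
    open ≡-Reasoning
    tf-e≡tf-e′ : tf e ≡ tf e′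
    tf-e≡tf-e′ = ℚP.≤-antisym (R7 x e′ e (λ e′≡e → e≢e′ (sym e′≡e)) tail′≡x tail≡x refl)
                              (R7 x e e′ e≢e′ tail≡x tail′≡x refl)

  Σflow≤throughput : ∀ K e → sumℚ (map (λ i → flow i K e) (allFin n)) ≤ tf e
  Σflow≤throughput zero e =
    subst (_≤ tf e) (sym (trans (sumℚ-map-const 0ℚ (allFin n)) (ℚP.*-zeroʳ (fromℕ (length (allFin n)))))) (proj₁ (t-range e))
  Σflow≤throughput (suc K) e with tail G e in tail≡
  ... | inj₁ j        = ℚP.≤-reflexive (trans (sumℚ-unitˡ j) (sym (R3-eq j e tail≡ refl)))
  ... | inj₂ (inj₂ o) = contradiction tail≡ (tail≢output e o)
  ... | inj₂ (inj₁ x) = begin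
    sumℚ (map (λ i → ½ * inflow (flow i K) (spV x)) (allFin n))   ≡⟨ sumℚ-map-*ˡ ½ (λ i → inflow (flow i K) (spV x)) (allFin n) ⟩
    ½ * sumℚ (map (λ i → inflow (flow i K) (spV x)) (allFin n))   ≡⟨ cong (½ *_) (sumℚ-map-swap (λ i a → flow i K a) (allFin n) (δ⁻ G (spV x))) ⟩
    ½ * inflow (λ a → sumℚ (map (λ i → flow i K a) (allFin n))) (spV x)
                                                                  ≤⟨ *-monoˡ-≤-nonNeg (ℚP.nonNegative⁻¹ ½) (sumℚ-map-mono (δ⁻ G (spV x)) (Σflow≤throughput K)) ⟩
    ½ * inflow tf (spV x)                                         ≡⟨ fluid-split tail≡ ⟨
    tf e                                                          ∎
    where open ℚP.≤-Reasoning

  flow≤1 : ∀ i K e → flow i K e ≤ 1ℚ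
  flow≤1 i K e = ℚP.≤-trans (∈⇒≤sumℚ-map (allFin n) (λ j → flow-nonNeg j K e) (∈-allFin i))
                   (ℚP.≤-trans (Σflow≤throughput K e) (proj₂ (t-range e)))

  ΣΣS⁻flow≤2s : ∀ K → sumℚ (map (λ i → ΣS⁻ (flow i K)) (allFin n)) ≤ fromℕ s * fromℕ 2
  ΣΣS⁻flow≤2s K = begin
    sumℚ (map (λ i → ΣS⁻ (flow i K)) (allFin n))
      ≡⟨ sumℚ-map-swap (λ i x → inflow (flow i K) (spV x)) (allFin n) (allFin s) ⟩
    sumℚ (map (λ x → sumℚ (map (λ i → inflow (flow i K) (spV x)) (allFin n))) (allFin s))
      ≡⟨ sumℚ-map-cong (allFin s) (λ x → sumℚ-map-swap (λ i e → flow i K e) (allFin n) (δ⁻ G (spV x))) ⟩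
    ΣS⁻ (λ e → sumℚ (map (λ i → flow i K e) (allFin n)))
      ≤⟨ ΣS⁻≤2s (λ e → ℚP.≤-trans (Σflow≤throughput K e) (proj₂ (t-range e))) ⟩
    fromℕ s * fromℕ 2 ∎
    where open ℚP.≤-Reasoning

  module BalancedCommodity .{{_ : NonZero p}} (i : Fin n) {t : Arc → ℚ} {F : Arc → Bool}
    (steady : IsSteadyState G (unit i) (λ _ → 1ℚ) t F)
    (balanced : ∀ e e′ o o′ → head G e ≡ outV o → head G e′ ≡ outV o′ → t e ≡ t e′) where

    private module S = IsSteadyState steady
    open BinaryExpansion (+ 1 / p) (1/-nonNeg p)

    -- By R7 a fluid out-arc e carries at least half of its splitter's inflow; by R8 each
    -- saturated in-arc of that splitter carries 1 unless t e = 1.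
    flow≤throughput-fluid : ∀ K e → F e ≡ true → flow i K e ≤ t e
    flow≤throughput-fluid zero e _ = proj₁ (S.t-range e)
    flow≤throughput-fluid (suc K) e Fe with tail G e in tail≡
    ... | inj₁ j        = ℚP.≤-reflexive (sym (S.R3-eq j e tail≡ Fe))
    ... | inj₂ (inj₂ o) = contradiction tail≡ (tail≢output e o)
    ... | inj₂ (inj₁ x) with t e ℚP.≟ 1ℚ
    ...   | yes te≡1 = subst₂ _≤_ (cong (emitted i K) tail≡) (sym te≡1) (flow≤1 i (suc K) e)
    ...   | no  te≢1 with sibling tail≡
    ...     | e′ , e≢e′ , tail′≡x , outflow≡ = begin
      ½ * inflow (flow i K) (spV x)  ≤⟨ *-monoˡ-≤-nonNeg (ℚP.nonNegative⁻¹ ½) (sumℚ-map-mono-∈ (δ⁻ G (spV x)) in-arc-bound) ⟩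
      ½ * inflow t (spV x)           ≡⟨ cong (½ *_) (trans (S.R5 x) (outflow≡ t)) ⟩
      ½ * (t e + t e′)               ≤⟨ *-monoˡ-≤-nonNeg (ℚP.nonNegative⁻¹ ½) (ℚP.+-monoʳ-≤ (t e) (S.R7 x e e′ e≢e′ tail≡ tail′≡x Fe)) ⟩
      ½ * (t e + t e)                ≡⟨ solve 1 (λ a → con ½ :* (a :+ a) := a) refl (t e) ⟩
      t e                            ∎
      where
      open ℚP.≤-Reasoning
      in-arc-bound : ∀ a → a ∈ δ⁻ G (spV x) → flow i K a ≤ t a
      in-arc-bound a a∈ with F a in Fa
      ... | true  = flow≤throughput-fluid K a Fa
      ... | false with S.R8 a e (trans (∈δ⁻⇒head a∈) (sym tail≡)) Fa Fe
      ...   | inj₁ ta≡1 = subst (flow i K a ≤_) (sym ta≡1) (flow≤1 i K a)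
      ...   | inj₂ te≡1 = contradiction te≡1 te≢1

    flow≤throughput-output : ∀ K o → flow i K (outArc o) ≤ t (outArc o)
    flow≤throughput-output K o with F (outArc o) in Fo
    ... | true  = flow≤throughput-fluid K (outArc o) Fo
    ... | false = subst (flow i K (outArc o) ≤_) (sym (S.R4-eq o (outArc o) (head-outArc o) Fo)) (flow≤1 i K (outArc o))

    p*output≤1 : ∀ o → fromℕ p * t (outArc o) ≤ 1ℚ
    p*output≤1 o = begin
      fromℕ p * t (outArc o)                        ≡⟨ cong (λ k → fromℕ k * t (outArc o)) (length-allFin p) ⟨
      fromℕ (length (allFin p)) * t (outArc o)      ≡⟨ sumℚ-map-const (t (outArc o)) (allFin p) ⟨
      sumℚ (map (λ _ → t (outArc o)) (allFin p))    ≡⟨ sumℚ-map-cong (allFin p) (λ o′ → balanced _ _ o o′ (head-outArc o) (head-outArc o′)) ⟩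
      sumℚ (map (λ o′ → t (outArc o′)) (allFin p))  ≡⟨ sumℚ-map-cong (allFin p) (sumℚ-δ⁻-output t) ⟨
      ΣO⁻ t                                         ≡⟨ throughput-conservation steady ⟩
      ΣI⁺ t                                         ≡⟨ sumℚ-map-cong (allFin n) (sumℚ-δ⁺-input t) ⟩
      sumℚ (map (λ j → t (inArc j)) (allFin n))     ≤⟨ sumℚ-map-mono (allFin n) (λ j → S.R3-le j (inArc j) (tail-inArc j)) ⟩
      sumℚ (map (unit i) (allFin n))                ≡⟨ sumℚ-unitʳ i ⟩
      1ℚ                                            ∎
      where open ℚP.≤-Reasoning

    output-flow≤truncation : ∀ K o → flow i (suc K) (outArc o) ≤ truncation K
    output-flow≤truncation K o = subst (_≤ truncation K) (sym flow≡) (≤x⇒≤truncation K z (subst (_≤ + 1 / p) flow≡ flow≤1/p))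
      where
      z : ℕ
      z = proj₁ (flow-dyadic i K (outArc o))
      flow≡ : flow i (suc K) (outArc o) ≡ fromℕ z * ½ᵏ K
      flow≡ = *2ᵏ≡⇒≡*½ᵏ K z (proj₂ (flow-dyadic i K (outArc o)))
      flow≤1/p : flow i (suc K) (outArc o) ≤ + 1 / p
      flow≤1/p = d*y≤1⇒y≤1/d p (ℚP.≤-trans (*-monoˡ-≤-nonNeg (fromℕ-nonNeg p) (flow≤throughput-output (suc K) o)) (p*output≤1 o))

    p*truncationDefect≤ΣS⁻flow : ∀ K → fromℕ p * truncationDefect K ≤ ΣS⁻ (flow i K)
    p*truncationDefect≤ΣS⁻flow zero = subst (_≤ ΣS⁻ (flow i 0)) (sym (ℚP.*-zeroʳ (fromℕ p)))
      (sumℚ-map-nonNeg (allFin s) (λ x → sumℚ-map-nonNeg (δ⁻ G (spV x)) (flow-nonNeg i 0)))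
    p*truncationDefect≤ΣS⁻flow (suc K) = begin
      fromℕ p * truncationDefect (suc K)               ≡⟨ cong (fromℕ p *_) (sumℚ-upTo-suc (λ k → + 1 / p - truncation k) K) ⟩
      fromℕ p * (truncationDefect K + (+ 1 / p - truncation K))
        ≡⟨ solve 4 (λ P D X Y → P :* (D :+ (X :- Y)) := P :* D :+ (P :* X :- P :* Y)) refl (fromℕ p) (truncationDefect K) (+ 1 / p) (truncation K) ⟩
      fromℕ p * truncationDefect K + (fromℕ p * (+ 1 / p) - fromℕ p * truncation K)
        ≡⟨ cong (λ z → fromℕ p * truncationDefect K + (z - fromℕ p * truncation K)) (trans (ℚP.*-comm (fromℕ p) _) (1/d*d≡1 p)) ⟩
      fromℕ p * truncationDefect K + (1ℚ - fromℕ p * truncation K)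
        ≤⟨ ℚP.+-mono-≤ (p*truncationDefect≤ΣS⁻flow K) (ℚP.+-monoʳ-≤ 1ℚ (ℚP.neg-antimono-≤ delivered≤)) ⟩
      ΣS⁻ (flow i K) + (1ℚ - delivered)                ≡⟨ solve 2 (λ A C → A :+ (con 1ℚ :- C) := (con 1ℚ :+ A) :- C) refl (ΣS⁻ (flow i K)) delivered ⟩
      (1ℚ + ΣS⁻ (flow i K)) - delivered                ≡⟨ cong (_- delivered) (flow-recurrence i K) ⟨
      (ΣS⁻ (flow i (suc K)) + delivered) - delivered   ≡⟨ solve 2 (λ B C → (B :+ C) :- C := B) refl (ΣS⁻ (flow i (suc K))) delivered ⟩
      ΣS⁻ (flow i (suc K))                             ∎
      where
      open ℚP.≤-Reasoning
      delivered : ℚ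
      delivered = ΣO⁻ (flow i (suc K))
      delivered≤ : delivered ≤ fromℕ p * truncation K
      delivered≤ = begin
        delivered                                            ≡⟨ sumℚ-map-cong (allFin p) (sumℚ-δ⁻-output (flow i (suc K))) ⟩
        sumℚ (map (λ o → flow i (suc K) (outArc o)) (allFin p)) ≤⟨ sumℚ-map-≤-const (allFin p) (output-flow≤truncation K) ⟩
        fromℕ (length (allFin p)) * truncation K             ≡⟨ cong (λ k → fromℕ k * truncation K) (length-allFin p) ⟩
        fromℕ p * truncation K                               ∎

  module _ .{{_ : NonZero p}} where
    open BinaryExpansion (+ 1 / p) (1/-nonNeg p)

    n*p*truncationDefect≤ΣS⁻flows : IsBalancer G → ∀ K →
      fromℕ n * (fromℕ p * truncationDefect K) ≤ sumℚ (map (λ i → ΣS⁻ (flow i K)) (allFin n))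
    n*p*truncationDefect≤ΣS⁻flows balancer K = begin
      fromℕ n * c                                    ≡⟨ cong (λ k → fromℕ k * c) (length-allFin n) ⟨
      fromℕ (length (allFin n)) * c                  ≡⟨ sumℚ-map-const c (allFin n) ⟨
      sumℚ (map (λ _ → c) (allFin n))               ≤⟨ sumℚ-map-mono (allFin n) commodity-bound ⟩
      sumℚ (map (λ i → ΣS⁻ (flow i K)) (allFin n))  ∎
      where
      open ℚP.≤-Reasoning
      c : ℚ
      c = fromℕ p * truncationDefect K
      commodity-bound : ∀ i → c ≤ ΣS⁻ (flow i K)
      commodity-bound i =
        let (_ , _ , steady , balanced) = balancer (unit i) (λ j → unit-nonNeg i j , unit≤1 i j)
        in BalancedCommodity.p*truncationDefect≤ΣS⁻flow i steady balanced K

theorem3 : ∀ {n s p} (G : SplitterNetwork n s p) .{{_ : NonZero p}} →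
    IsBalancer G →
    Σ (Fin (m G) → ℚ) (λ t → IsSteadyState G (λ _ → 1ℚ) (λ _ → 1ℚ) t (λ _ → true)) →
    ∀ (K : ℕ) → ½ * (+ n / 1) * (+ p / 1) * digitSum K (+ 1 / p) ≤ (+ s / 1)
theorem3 {n} {s} {p} G balancer (tf , fluid) K = begin
  ½ * fromℕ n * fromℕ p * digitSum K x
    ≡⟨ solve 3 (λ a b d → con ½ :* a :* b :* d := con ½ :* (a :* (b :* d))) refl (fromℕ n) (fromℕ p) (digitSum K x) ⟩
  ½ * (fromℕ n * (fromℕ p * digitSum K x))
    ≤⟨ ½*-mono (*-monoˡ-≤-nonNeg (fromℕ-nonNeg n) (*-monoˡ-≤-nonNeg (fromℕ-nonNeg p) (digitSum≤truncationDefect K))) ⟩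
  ½ * (fromℕ n * (fromℕ p * truncationDefect K))
    ≤⟨ ½*-mono (n*p*truncationDefect≤ΣS⁻flows balancer K) ⟩
  ½ * sumℚ (map (λ i → ΣS⁻ (flow i K)) (allFin n))
    ≤⟨ ½*-mono (ΣΣS⁻flow≤2s K) ⟩
  ½ * (fromℕ s * fromℕ 2)
    ≡⟨ solve 1 (λ a → con ½ :* (a :* con (fromℕ 2)) := a) refl (fromℕ s) ⟩
  fromℕ s ∎
  where
  open ℚP.≤-Reasoning
  open Network G
  open Commodities G
  open AllFluid G tf fluid
  x : ℚ
  x = + 1 / p
  open BinaryExpansion x (1/-nonNeg p)
  ½*-mono : ∀ {a b} → a ≤ b → ½ * a ≤ ½ * b
  ½*-mono = *-monoˡ-≤-nonNeg (ℚP.nonNegative⁻¹ ½)
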